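{- Let $k$ be even and $n$ an integer with $2\le k\le n-1$. Then the Harary graph $H_{k,n}$ satisfies \[\operatorname{gon}(H_{k,n})\le \frac{k(k+1)(k+2)}{12}.\]
   Context: For $n\ge3$ and even $k$ with $2\le k\le n-1$, $H_{k,n}$ has vertices $v_1,\ldots,v_n$, with $v_i$ adjacent to $v_m$ if and only if $|i-m|\bmod n\in\{1,\ldots,k/2\}$. For a connected loopless multigraph $G$: a divisor is a function $D:V(G)\to\mathbb{Z}$; effective if all values are $\ge0$; degree $\sum_vD(v)$. Firing a vertex $v$ moves one chip from $v$ along each incident edge; divisors are equivalent if related by a sequence of firings. $D$ has positive rank if for every vertex $q$, $D-q$ is equivalent to an effective divisor. $\operatorname{gon}(G)$ is the minimum degree of a positive rank divisor. -}

module Defs where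

open import Data.Nat as ℕ using (ℕ; zero; suc; _∸_; _≤ᵇ_; _%_; _/_)
open import Data.Bool using (Bool; true; false; _∧_; _∨_; if_then_else_)
open import Data.Fin using (Fin; toℕ; _≟_)
import Data.Fin as Fin
open import Data.Integer as ℤ using (ℤ; +_; _≤_)
open import Data.Product using (Σ; _×_; _,_)
open import Data.Sum using (_⊎_)
open import Relation.Nullary using (yes; no)
open import Relation.Binary.PropositionalEquality using (_≡_)
open import Relation.Binary.Construct.Closure.ReflexiveTransitive using (Star)

sumℤ : (n : ℕ) → (Fin n → ℤ) → ℤ
sumℤ zero    f = + 0
sumℤ (suc n) f = f Fin.zero ℤ.+ sumℤ n (λ i → f (Fin.suc i))

-- Harary graph H_{k,n} on vertices Fin n (v_1..v_n ↦ 0..n-1).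
-- v_i ~ v_m iff the cyclic difference (i - m) mod n or (m - i) mod n
-- lies in {1, ..., k/2}.

inRange : ℕ → ℕ → Bool
inRange h d = (1 ≤ᵇ d) ∧ (d ≤ᵇ h)

hararyAdj : (k n : ℕ) → Fin n → Fin n → Bool
hararyAdj k zero    () _
hararyAdj k (suc n) i m =
  inRange (k / 2) ((toℕ i ℕ.+ suc n ∸ toℕ m) % suc n)
  ∨ inRange (k / 2) ((toℕ m ℕ.+ suc n ∸ toℕ i) % suc n)

hararyEdges : (k n : ℕ) → Fin n → Fin n → ℕ
hararyEdges k n v w = if hararyAdj k n v w then 1 else 0

Divisor : ℕ → Set
Divisor n = Fin n → ℤ

module _ {n : ℕ} (E : Fin n → Fin n → ℕ) where

  valence : Fin n → ℤ
  valence v = sumℤ n (λ w → + E v w)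

  fire : Fin n → Divisor n → Divisor n
  fire v D w with v ≟ w
  ... | yes _ = D w ℤ.- valence v
  ... | no  _ = D w ℤ.+ + E v w

  FireStep : Divisor n → Divisor n → Set
  FireStep D D′ = Σ (Fin n) (λ v → (∀ w → fire v D w ≡ D′ w) ⊎ (∀ w → fire v D′ w ≡ D w))

  _∼_ : Divisor n → Divisor n → Set
  _∼_ = Star FireStep

  Effective : Divisor n → Set
  Effective D = ∀ v → + 0 ≤ D v

  degree : Divisor n → ℤ
  degree D = sumℤ n D

  minusPoint : Divisor n → Fin n → Divisor n
  minusPoint D q w with q ≟ w
  ... | yes _ = D w ℤ.- + 1
  ... | no  _ = D w

  PositiveRank : Divisor n → Set
  PositiveRank D = ∀ q → Σ (Divisor n) (λ E′ → Effective E′ × (minusPoint D q ∼ E′))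

  -- gon(G) ≤ b  (gon is the minimum degree of a positive rank divisor)
  GonalityAtMost : ℤ → Set
  GonalityAtMost b = Σ (Divisor n) (λ D → PositiveRank D × degree D ≤ b)

-- Write h = k/2 and number the vertices 0, …, n-1. At an interior vertex c, with
-- h ≤ c and c + h < n, no neighbourhood wraps around the cycle, and firing c adds
-- to a divisor the second difference  tent (c-1) + tent (c+1) - 2 tent c  of the
-- tents  tent c x = T (h ∸ ∣ c - x ∣),  T the triangular numbers: off c it is 1
-- exactly on the 2h neighbours of c, and at c it is -2h. Firing L+1, …, R in turn
-- therefore telescopes to moving tent (L+1) + tent R to tent L + tent (R+1).
-- Starting with two tents in the middle and pushing them apart until they sit at
-- h-1 and n-h, every vertex at some point lies within distance h-1 of a tent and
-- so carries a chip; hence the starting divisor has positive rank. A tent has mass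
-- at most (T 1 + … + T (h-1)) + (T 1 + … + T h) = 1² + … + h², so the degree is at
-- most 2 (1² + … + h²) = k(k+1)(k+2)/12.
module Submission where

open import Defs
open import Algebra.Properties.CommutativeSemigroup using (interchange)
open import Data.Bool.Base using (false; _∨_; if_then_else_)
open import Data.Bool.Properties using (∨-comm; ∨-identityʳ)
open import Data.Empty using (⊥-elim)
open import Data.Fin.Base as Fin using (Fin; toℕ; fromℕ<)
open import Data.Fin.Properties using (_≟_; toℕ<n; toℕ-fromℕ<; toℕ-injective)
open import Data.Integer.Base as ℤ using (ℤ; +_; +≤+)
import Data.Integer.Properties as ℤ
import Data.Integer.Tactic.RingSolver as ℤ-Solver
open import Data.List.Base using (applyUpTo; [_]; _++_)
open import Data.List.Properties using (applyUpTo-∷ʳ)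
open import Data.Nat.Base
open import Data.Nat.Divisibility using (_∣_; divides)
open import Data.Nat.DivMod using ([m+n]%n≡m%n; m<n⇒m%n≡m; n%n≡0; m*n/n≡m)
open import Data.Nat.ListAction using (sum)
open import Data.Nat.ListAction.Properties using (sum-++)
open import Data.Nat.Properties hiding (_≟_)
open import Data.Nat.Tactic.RingSolver using (solve-∀)
open import Data.Product.Base using (Σ; _×_; _,_)
open import Data.Sum.Base using (inj₁; inj₂)
open import Function.Base using (_∘_)
open import Relation.Binary.Construct.Closure.ReflexiveTransitive using (ε; _◅_; _◅◅_)
open import Relation.Binary.PropositionalEquality
  using (_≡_; _≢_; _≗_; refl; sym; trans; cong; cong₂; subst; module ≡-Reasoning)
open import Relation.Nullary.Decidable.Core using (yes; no)

sum-applyUpTo-0 : ∀ n → sum (applyUpTo (λ _ → 0) n) ≡ 0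
sum-applyUpTo-0 zero    = refl
sum-applyUpTo-0 (suc n) = sum-applyUpTo-0 n

sum-applyUpTo-+ : ∀ f g n →
  sum (applyUpTo (λ x → f x + g x) n) ≡ sum (applyUpTo f n) + sum (applyUpTo g n)
sum-applyUpTo-+ f g zero    = refl
sum-applyUpTo-+ f g (suc n) = begin
  f 0 + g 0 + sum (applyUpTo (λ x → f (suc x) + g (suc x)) n)
    ≡⟨ cong (_+_ (f 0 + g 0)) (sum-applyUpTo-+ (f ∘ suc) (g ∘ suc) n) ⟩
  f 0 + g 0 + (sum (applyUpTo (f ∘ suc) n) + sum (applyUpTo (g ∘ suc) n))
    ≡⟨ interchange +-commutativeSemigroup (f 0) (g 0) _ _ ⟩
  f 0 + sum (applyUpTo (f ∘ suc) n) + (g 0 + sum (applyUpTo (g ∘ suc) n)) ∎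
  where open ≡-Reasoning

sum-applyUpTo-suc : ∀ f n → sum (applyUpTo f (suc n)) ≡ sum (applyUpTo f n) + f n
sum-applyUpTo-suc f n = begin
  sum (applyUpTo f (suc n))        ≡⟨ cong sum (applyUpTo-∷ʳ f n) ⟨
  sum (applyUpTo f n ++ [ f n ])   ≡⟨ sum-++ (applyUpTo f n) [ f n ] ⟩
  sum (applyUpTo f n) + (f n + 0)  ≡⟨ cong (_+_ (sum (applyUpTo f n))) (+-identityʳ (f n)) ⟩
  sum (applyUpTo f n) + f n        ∎
  where open ≡-Reasoning

sum-applyUpTo-∣-∣ : ∀ f {c n} → c ≤ n →
  sum (applyUpTo (λ x → f ∣ c - x ∣) n)
    ≡ sum (applyUpTo (f ∘ suc) c) + sum (applyUpTo f (n ∸ c))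
sum-applyUpTo-∣-∣ f {zero}          _         = refl
sum-applyUpTo-∣-∣ f {suc c} {suc n} (s≤s c≤n) = begin
  f (suc c) + sum (applyUpTo (λ x → f ∣ c - x ∣) n)
    ≡⟨ cong (_+_ (f (suc c))) (sum-applyUpTo-∣-∣ f c≤n) ⟩
  f (suc c) + (sum (applyUpTo (f ∘ suc) c) + rest)
    ≡⟨ +-assoc (f (suc c)) _ rest ⟨
  f (suc c) + sum (applyUpTo (f ∘ suc) c) + rest
    ≡⟨ cong (_+ rest) (+-comm (f (suc c)) _) ⟩
  sum (applyUpTo (f ∘ suc) c) + f (suc c) + rest
    ≡⟨ cong (_+ rest) (sum-applyUpTo-suc (f ∘ suc) c) ⟨
  sum (applyUpTo (f ∘ suc) (suc c)) + rest ∎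
  where
  open ≡-Reasoning
  rest : ℕ
  rest = sum (applyUpTo f (n ∸ c))

sumℤ≡+sum : ∀ n (g : Fin n → ℤ) (f : ℕ → ℕ) → (∀ w → g w ≡ + f (toℕ w)) →
  sumℤ n g ≡ + sum (applyUpTo f n)
sumℤ≡+sum zero    g f _  = refl
sumℤ≡+sum (suc n) g f eq =
  cong₂ ℤ._+_ (eq Fin.zero) (sumℤ≡+sum n (g ∘ Fin.suc) (f ∘ suc) (eq ∘ Fin.suc))

edgesAtDistance : ℕ → ℕ → ℕ
edgesAtDistance h d = if inRange h d then 1 else 0

sum-edgesAtDistance : ∀ h c → sum (applyUpTo (λ d → edgesAtDistance h (suc d)) c) ≡ c ⊓ h
sum-edgesAtDistance h       zero    = refl
sum-edgesAtDistance zero    (suc c) = sum-applyUpTo-0 c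
sum-edgesAtDistance (suc h) (suc c) = cong suc (sum-edgesAtDistance h c)

sum-edgesAtDistance-∣-∣ : ∀ {h c n} → h ≤ c → c + h ≤ n →
  sum (applyUpTo (λ x → edgesAtDistance h ∣ c - x ∣) (suc n)) ≡ h + h
sum-edgesAtDistance-∣-∣ {h} {c} {n} h≤c c+h≤n = begin
  sum (applyUpTo (λ x → edgesAtDistance h ∣ c - x ∣) (suc n))
    ≡⟨ sum-applyUpTo-∣-∣ (edgesAtDistance h) (m≤n⇒m≤1+n c≤n) ⟩
  left + sum (applyUpTo (edgesAtDistance h) (suc n ∸ c))
    ≡⟨ cong (λ m → left + sum (applyUpTo (edgesAtDistance h) m)) (+-∸-assoc 1 c≤n) ⟩
  left + sum (applyUpTo (edgesAtDistance h ∘ suc) (n ∸ c))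
    ≡⟨ cong₂ _+_ (sum-edgesAtDistance h c) (sum-edgesAtDistance h (n ∸ c)) ⟩
  c ⊓ h + (n ∸ c) ⊓ h
    ≡⟨ cong₂ _+_ (m≥n⇒m⊓n≡n h≤c) (m≥n⇒m⊓n≡n h≤n∸c) ⟩
  h + h ∎
  where
  open ≡-Reasoning
  c≤n : c ≤ n
  c≤n = ≤-trans (m≤m+n c h) c+h≤n
  h≤n∸c : h ≤ n ∸ c
  h≤n∸c = m+n≤o⇒m≤o∸n h (subst (_≤ n) (+-comm c h) c+h≤n)
  left : ℕ
  left = sum (applyUpTo (edgesAtDistance h ∘ suc) c)

triangle : ℕ → ℕ
triangle zero    = 0
triangle (suc m) = suc m + triangle m

tetrahedral : ℕ → ℕ
tetrahedral zero    = 0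
tetrahedral (suc m) = triangle (suc m) + tetrahedral m

triangle-second-difference : ∀ h m →
  triangle (h ∸ m) + triangle (h ∸ suc (suc m))
    ≡ triangle (h ∸ suc m) + triangle (h ∸ suc m) + edgesAtDistance h (suc m)
triangle-second-difference zero          zero    = refl
triangle-second-difference zero          (suc m) = refl
triangle-second-difference (suc zero)    zero    = refl
triangle-second-difference (suc (suc h)) zero    = expand h (triangle h)
  where
  expand : ∀ h t → suc (suc h) + (suc h + t) + t ≡ suc h + t + (suc h + t) + 1
  expand = solve-∀
triangle-second-difference (suc h)       (suc m) = triangle-second-difference h m

triangle-peak : ∀ h → triangle (h ∸ 1) + triangle (h ∸ 1) + (h + h) ≡ triangle h + triangle h
triangle-peak zero    = refl
triangle-peak (suc h) = expand h (triangle h)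
  where
  expand : ∀ h t → t + t + (suc h + suc h) ≡ suc h + t + (suc h + t)
  expand = solve-∀

sum-triangle-∸ : ∀ h m → sum (applyUpTo (λ d → triangle (h ∸ d)) m) ≤ tetrahedral h
sum-triangle-∸ h       zero    = z≤n
sum-triangle-∸ zero    (suc m) = ≤-reflexive (sum-applyUpTo-0 m)
sum-triangle-∸ (suc h) (suc m) = +-monoʳ-≤ (triangle (suc h)) (sum-triangle-∸ h m)

triangle-closed : ∀ m → triangle m * 2 ≡ m * (m + 1)
triangle-closed zero    = refl
triangle-closed (suc m) = begin
  (suc m + triangle m) * 2     ≡⟨ *-distribʳ-+ 2 (suc m) (triangle m) ⟩
  suc m * 2 + triangle m * 2   ≡⟨ cong (_+_ (suc m * 2)) (triangle-closed m) ⟩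
  suc m * 2 + m * (m + 1)      ≡⟨ expand m ⟩
  suc m * (suc m + 1)          ∎
  where
  open ≡-Reasoning
  expand : ∀ m → suc m * 2 + m * (m + 1) ≡ suc m * (suc m + 1)
  expand = solve-∀

tetrahedral-closed : ∀ m → tetrahedral m * 6 ≡ m * (m + 1) * (m + 2)
tetrahedral-closed zero    = refl
tetrahedral-closed (suc m) = begin
  (triangle (suc m) + tetrahedral m) * 6
    ≡⟨ *-distribʳ-+ 6 (triangle (suc m)) (tetrahedral m) ⟩
  triangle (suc m) * 6 + tetrahedral m * 6
    ≡⟨ cong (_+ tetrahedral m * 6) (*-assoc (triangle (suc m)) 2 3) ⟨
  triangle (suc m) * 2 * 3 + tetrahedral m * 6
    ≡⟨ cong₂ _+_ (cong (_* 3) (triangle-closed (suc m))) (tetrahedral-closed m) ⟩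
  suc m * (suc m + 1) * 3 + m * (m + 1) * (m + 2)
    ≡⟨ expand m ⟩
  suc m * (suc m + 1) * (suc m + 2) ∎
  where
  open ≡-Reasoning
  expand : ∀ m → suc m * (suc m + 1) * 3 + m * (m + 1) * (m + 2) ≡ suc m * (suc m + 1) * (suc m + 2)
  expand = solve-∀

tetrahedral-pair : ∀ h → (tetrahedral h + tetrahedral (suc h)) * 24
  ≡ suc h * 2 * (suc h * 2 + 1) * (suc h * 2 + 2)
tetrahedral-pair h = begin
  (tetrahedral h + tetrahedral (suc h)) * 24
    ≡⟨ regroup (tetrahedral h) (tetrahedral (suc h)) ⟩
  tetrahedral h * 6 * 4 + tetrahedral (suc h) * 6 * 4
    ≡⟨ cong₂ (λ a b → a * 4 + b * 4) (tetrahedral-closed h) (tetrahedral-closed (suc h)) ⟩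
  h * (h + 1) * (h + 2) * 4 + suc h * (suc h + 1) * (suc h + 2) * 4
    ≡⟨ expand h ⟩
  suc h * 2 * (suc h * 2 + 1) * (suc h * 2 + 2) ∎
  where
  open ≡-Reasoning
  regroup : ∀ a b → (a + b) * 24 ≡ a * 6 * 4 + b * 6 * 4
  regroup = solve-∀
  expand : ∀ h → h * (h + 1) * (h + 2) * 4 + suc h * (suc h + 1) * (suc h + 2) * 4
    ≡ suc h * 2 * (suc h * 2 + 1) * (suc h * 2 + 2)
  expand = solve-∀

tent : ℕ → ℕ → ℕ → ℕ
tent h c x = triangle (h ∸ ∣ c - x ∣)

tent-second-difference : ∀ h j x → x ≢ suc j →
  tent h j x + tent h (suc (suc j)) x
    ≡ tent h (suc j) x + tent h (suc j) x + edgesAtDistance h ∣ suc j - x ∣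
tent-second-difference h j       zero          _   rewrite ∣-∣-identityʳ j =
  triangle-second-difference h j
tent-second-difference h zero    (suc zero)    x≢1 = ⊥-elim (x≢1 refl)
tent-second-difference h zero    (suc (suc x)) _   =
  trans (+-comm (triangle (h ∸ suc (suc x))) _) (triangle-second-difference h x)
tent-second-difference h (suc j) (suc x)       x≢c = tent-second-difference h j x (x≢c ∘ cong suc)

tent-peak : ∀ h j x → x ≡ suc j →
  tent h j x + tent h (suc (suc j)) x + (h + h) ≡ tent h (suc j) x + tent h (suc j) x
tent-peak h zero    _ refl = triangle-peak h
tent-peak h (suc j) _ refl = tent-peak h j (suc j) refl

tent-positive : ∀ {h c x} → ∣ c - x ∣ < h → 0 < tent h c x
tent-positive {h} {c} {x} d<h with h ∸ ∣ c - x ∣ | m<n⇒0<n∸m d<h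
... | suc _ | _ = z<s

sum-tent : ∀ h {c n} → c ≤ n →
  sum (applyUpTo (tent (suc h) c) n) ≤ tetrahedral h + tetrahedral (suc h)
sum-tent h {c} {n} c≤n = begin
  sum (applyUpTo (tent (suc h) c) n)
    ≡⟨ sum-applyUpTo-∣-∣ (λ d → triangle (suc h ∸ d)) c≤n ⟩
  sum (applyUpTo (λ d → triangle (h ∸ d)) c)
    + sum (applyUpTo (λ d → triangle (suc h ∸ d)) (n ∸ c))
    ≤⟨ +-mono-≤ (sum-triangle-∸ h c) (sum-triangle-∸ (suc h) (n ∸ c)) ⟩
  tetrahedral h + tetrahedral (suc h) ∎
  where open ≤-Reasoning

second-difference-ℤ : ∀ a b m {e r} → a + b + r ≡ m + m + e →
  (+ b ℤ.- + m) ℤ.- (+ m ℤ.- + a) ≡ + e ℤ.- + r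
second-difference-ℤ a b m {e} {r} eq = begin
  (+ b ℤ.- + m) ℤ.- (+ m ℤ.- + a)        ≡⟨ regroup (+ a) (+ b) (+ m) (+ r) ⟩
  + (a + b + r) ℤ.- + r ℤ.- + (m + m)    ≡⟨ cong (λ t → + t ℤ.- + r ℤ.- + (m + m)) eq ⟩
  + (m + m + e) ℤ.- + r ℤ.- + (m + m)    ≡⟨ cancel (+ m) (+ e) (+ r) ⟩
  + e ℤ.- + r                            ∎
  where
  open ≡-Reasoning
  regroup : ∀ A B M R → (B ℤ.- M) ℤ.- (M ℤ.- A) ≡ A ℤ.+ B ℤ.+ R ℤ.- R ℤ.- (M ℤ.+ M)
  regroup = ℤ-Solver.solve-∀
  cancel : ∀ M E R → M ℤ.+ M ℤ.+ E ℤ.- R ℤ.- (M ℤ.+ M) ≡ E ℤ.- R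
  cancel = ℤ-Solver.solve-∀

<ᵇ-false : ∀ {m n} → n ≤ m → (m <ᵇ n) ≡ false
<ᵇ-false z≤n       = refl
<ᵇ-false (s≤s n≤m) = <ᵇ-false n≤m

inRange-false : ∀ {h d} → h < d → inRange h d ≡ false
inRange-false (s≤s h≤d) = <ᵇ-false h≤d

inRange-wrapped : ∀ {n} h d → h + d < suc n → inRange h ((suc n ∸ d) % suc n) ≡ false
inRange-wrapped {n} h zero    _     = cong (inRange h) (n%n≡0 (suc n))
inRange-wrapped {n} h (suc d) h+d<N =
  trans (cong (inRange h) (m<n⇒m%n≡m (s≤s (m∸n≤m n d))))
        (inRange-false (m+n≤o⇒m≤o∸n (suc h) (subst (_≤ n) (+-suc h d) (s≤s⁻¹ h+d<N))))

inRange-cyclic-≤ : ∀ {n} h a d → a + d < suc n → h + d < suc n →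
  (inRange h ((a + d + suc n ∸ a) % suc n) ∨ inRange h ((a + suc n ∸ (a + d)) % suc n))
    ≡ inRange h d
inRange-cyclic-≤ {n} h a d a+d<N h+d<N = begin
  inRange h ((a + d + suc n ∸ a) % suc n) ∨ inRange h ((a + suc n ∸ (a + d)) % suc n)
    ≡⟨ cong₂ (λ x y → inRange h x ∨ inRange h y)
             unwrapped (cong (_% suc n) ([m+n]∸[m+o]≡n∸o a (suc n) d)) ⟩
  inRange h d ∨ inRange h ((suc n ∸ d) % suc n)
    ≡⟨ cong (inRange h d ∨_) (inRange-wrapped h d h+d<N) ⟩
  inRange h d ∨ false
    ≡⟨ ∨-identityʳ (inRange h d) ⟩
  inRange h d ∎
  where
  open ≡-Reasoning
  unwrapped : (a + d + suc n ∸ a) % suc n ≡ d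
  unwrapped = begin
    (a + d + suc n ∸ a) % suc n    ≡⟨ cong (λ m → (m ∸ a) % suc n) (+-assoc a d (suc n)) ⟩
    (a + (d + suc n) ∸ a) % suc n  ≡⟨ cong (_% suc n) (m+n∸m≡n a (d + suc n)) ⟩
    (d + suc n) % suc n            ≡⟨ [m+n]%n≡m%n d (suc n) ⟩
    d % suc n                      ≡⟨ m<n⇒m%n≡m (≤-<-trans (m≤n+m d a) a+d<N) ⟩
    d                              ∎

inRange-cyclic-interior : ∀ {n} h c x → h ≤ c → c + h < suc n → x < suc n →
  (inRange h ((c + suc n ∸ x) % suc n) ∨ inRange h ((x + suc n ∸ c) % suc n))
    ≡ inRange h ∣ c - x ∣
inRange-cyclic-interior {n} h c x h≤c c+h<N x<N with ≤-total x c
... | inj₁ x≤c with d , refl ← m≤n⇒∃[o]m+o≡n x≤c =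
  trans (inRange-cyclic-≤ h x d (≤-<-trans (m≤m+n (x + d) h) c+h<N) h+d<N)
        (cong (inRange h) (sym (trans (∣-∣-comm (x + d) x) (∣m-m+n∣≡n x d))))
  where
  h+d<N : h + d < suc n
  h+d<N = ≤-<-trans (≤-trans (+-monoʳ-≤ h (m≤n+m d x)) (≤-reflexive (+-comm h (x + d)))) c+h<N
... | inj₂ c≤x with d , refl ← m≤n⇒∃[o]m+o≡n c≤x =
  trans (∨-comm (inRange h ((c + suc n ∸ (c + d)) % suc n)) (inRange h ((c + d + suc n ∸ c) % suc n)))
        (trans (inRange-cyclic-≤ h c d x<N (≤-<-trans (+-monoˡ-≤ d h≤c) x<N))
               (cong (inRange h) (sym (∣m-m+n∣≡n c d))))

module Reachability {n : ℕ} (E : Fin n → Fin n → ℕ) where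

  infixl 6 _⊕_ _⊖_
  infix 4 _↝_

  _⊕_ _⊖_ : Divisor n → Divisor n → Divisor n
  (D ⊕ D′) w = D w ℤ.+ D′ w
  (D ⊖ D′) w = D w ℤ.- D′ w

  -- A firing sequence ends at a divisor known only up to ≗, and without function
  -- extensionality ∼ cannot be transported along ≗, so targets are reached up to ≗.
  _↝_ : Divisor n → Divisor n → Set
  G ↝ T = Σ (Divisor n) λ D → _∼_ E G D × D ≗ T

  FiringMove : Divisor n → Set
  FiringMove δ = Σ (Fin n) λ v → ∀ X → fire E v X ≗ X ⊕ δ

  ↝-respʳ-≗ : ∀ {G T T′} → T ≗ T′ → G ↝ T → G ↝ T′
  ↝-respʳ-≗ T≗T′ (D , G∼D , D≗T) = D , G∼D , λ w → trans (D≗T w) (T≗T′ w)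

  ↝-move : ∀ {G T δ} → FiringMove δ → G ↝ T → G ↝ T ⊕ δ
  ↝-move (v , fires) (D , G∼D , D≗T) =
    fire E v D , G∼D ◅◅ ((v , inj₁ (λ _ → refl)) ◅ ε) ,
    λ w → trans (fires D w) (cong (ℤ._+ _) (D≗T w))

  ↝-telescope : ∀ (g : ℕ → Divisor n) B {G L R} → L ≤′ R →
    (∀ {j} → L ≤ j → j < R → FiringMove (g (suc j) ⊖ g j)) →
    G ↝ B ⊕ g L → G ↝ B ⊕ g R
  ↝-telescope g B ≤′-refl          _     G↝ = G↝
  ↝-telescope g B (≤′-step L≤′R) moves G↝ =
    ↝-respʳ-≗ (λ w → cancel (B w) (g _ w) (g (suc _) w))
      (↝-move (moves (≤′⇒≤ L≤′R) ≤-refl)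
        (↝-telescope g B L≤′R (λ L≤j j<R → moves L≤j (m≤n⇒m≤1+n j<R)) G↝))
    where
    cancel : ∀ b x y → b ℤ.+ x ℤ.+ (y ℤ.- x) ≡ b ℤ.+ y
    cancel = ℤ-Solver.solve-∀

  minusPoint-≗ : ∀ D q → minusPoint E D q ≗ minusPoint E (λ _ → + 0) q ⊕ D
  minusPoint-≗ D q w with q ≟ w
  ... | yes _ = ℤ.+-comm (D w) (ℤ.- + 1)
  ... | no  _ = sym (ℤ.+-identityˡ (D w))

  minusPoint-effective : ∀ {D q} → Effective E D → + 1 ℤ.≤ D q → Effective E (minusPoint E D q)
  minusPoint-effective {D} {q} D≥0 Dq≥1 w with q ≟ w
  ... | yes refl = ℤ.i≤j⇒0≤j-i Dq≥1
  ... | no  _    = D≥0 w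

  positiveRank-↝ : ∀ {D} →
    (∀ q → Σ (Divisor n) λ D′ → Effective E D′ × minusPoint E D q ↝ D′) → PositiveRank E D
  positiveRank-↝ reach q with reach q
  ... | D′ , D′≥0 , D″ , D∼D″ , D″≗D′ =
    D″ , (λ w → subst (+ 0 ℤ.≤_) (sym (D″≗D′ w)) (D′≥0 w)) , D∼D″

module HararyInterior (h n : ℕ) where

  E : Fin (suc n) → Fin (suc n) → ℕ
  E = hararyEdges (h * 2) (suc n)

  open Reachability E

  Interior : ℕ → Set
  Interior c = h ≤ c × c + h < suc n

  h*2/2≡h : h * 2 / 2 ≡ h
  h*2/2≡h = m*n/n≡m h 2

  edges-interior : ∀ {v} w → Interior (toℕ v) → E v w ≡ edgesAtDistance h ∣ toℕ v - toℕ w ∣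
  edges-interior {v} w (h≤c , c+h<N) rewrite h*2/2≡h =
    cong (λ b → if b then 1 else 0)
         (inRange-cyclic-interior h (toℕ v) (toℕ w) h≤c c+h<N (toℕ<n w))

  valence-interior : ∀ {v} → Interior (toℕ v) → valence E v ≡ + (h + h)
  valence-interior {v} int@(h≤c , c+h<N) =
    trans (sumℤ≡+sum (suc n) _ (λ x → edgesAtDistance h ∣ toℕ v - x ∣)
                     (λ w → cong +_ (edges-interior w int)))
          (cong +_ (sum-edgesAtDistance-∣-∣ h≤c (s≤s⁻¹ c+h<N)))

  slope : ℕ → Divisor (suc n)
  slope c w = + tent h (suc c) (toℕ w) ℤ.- + tent h c (toℕ w)

  firingMove-interior : ∀ {j} → Interior (suc j) → FiringMove (slope (suc j) ⊖ slope j)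
  firingMove-interior {j} int@(_ , c+h<N) = v , fires
    where
    open ≡-Reasoning
    c<N : suc j < suc n
    c<N = ≤-<-trans (m≤m+n (suc j) h) c+h<N
    v : Fin (suc n)
    v = fromℕ< c<N
    toℕv : toℕ v ≡ suc j
    toℕv = toℕ-fromℕ< c<N
    int-v : Interior (toℕ v)
    int-v = subst Interior (sym toℕv) int
    fires : ∀ X w → fire E v X w ≡ X w ℤ.+ (slope (suc j) w ℤ.- slope j w)
    fires X w with v ≟ w
    ... | yes refl = cong (ℤ._+_ (X v)) (begin
      ℤ.- valence E v          ≡⟨ cong ℤ.-_ (valence-interior int-v) ⟩
      ℤ.- + (h + h)            ≡⟨ ℤ.+-identityˡ (ℤ.- + (h + h)) ⟨
      + 0 ℤ.- + (h + h)
        ≡⟨ second-difference-ℤ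
             (tent h j (toℕ v)) (tent h (suc (suc j)) (toℕ v)) (tent h (suc j) (toℕ v))
             (trans (tent-peak h j (toℕ v) toℕv) (sym (+-identityʳ _))) ⟨
      slope (suc j) v ℤ.- slope j v ∎)
    ... | no v≢w = cong (ℤ._+_ (X w)) (begin
      + E v w                                  ≡⟨ cong +_ (edges-interior w int-v) ⟩
      + edgesAtDistance h ∣ toℕ v - toℕ w ∣    ≡⟨ cong (λ c → + edgesAtDistance h ∣ c - toℕ w ∣) toℕv ⟩
      + edgesAtDistance h ∣ suc j - toℕ w ∣    ≡⟨ ℤ.+-identityʳ _ ⟨
      + edgesAtDistance h ∣ suc j - toℕ w ∣ ℤ.- + 0
        ≡⟨ second-difference-ℤ
             (tent h j (toℕ w)) (tent h (suc (suc j)) (toℕ w)) (tent h (suc j) (toℕ w))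
             (trans (+-identityʳ _) (tent-second-difference h j (toℕ w) w≢v)) ⟨
      slope (suc j) w ℤ.- slope j w ∎)
      where
      w≢v : toℕ w ≢ suc j
      w≢v eq = v≢w (toℕ-injective (trans toℕv (sym eq)))

  tents : ℕ → ℕ → Divisor (suc n)
  tents L R w = + (tent h L (toℕ w) + tent h R (toℕ w))

  spread-step : ∀ {G B L R} → h ≤ suc L → L ≤ R → R + h < suc n →
    G ↝ B ⊕ tents (suc L) R → G ↝ B ⊕ tents L (suc R)
  spread-step {G} {B} {L} {R} h≤1+L L≤R R+h<N G↝ =
    ↝-respʳ-≗ (λ w → close (B w) (t L w) (t R w) (t (suc R) w))
      (↝-telescope slope (B ⊕ tents L R) (≤⇒≤′ L≤R) move
        (↝-respʳ-≗ (λ w → split (B w) (t L w) (t R w) (t (suc L) w)) G↝))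
    where
    t : ℕ → Divisor (suc n)
    t c w = + tent h c (toℕ w)
    move : ∀ {j} → L ≤ j → j < R → FiringMove (slope (suc j) ⊖ slope j)
    move L≤j j<R =
      firingMove-interior (≤-trans h≤1+L (s≤s L≤j) , ≤-<-trans (+-monoˡ-≤ h j<R) R+h<N)
    split : ∀ b x y z → b ℤ.+ (z ℤ.+ y) ≡ b ℤ.+ (x ℤ.+ y) ℤ.+ (z ℤ.- x)
    split = ℤ-Solver.solve-∀
    close : ∀ b x y z → b ℤ.+ (x ℤ.+ y) ℤ.+ (z ℤ.- y) ≡ b ℤ.+ (x ℤ.+ z)
    close = ℤ-Solver.solve-∀

  spread : ∀ s {G B L R} → h ≤ suc L → s + L ≤ R → s + R + h ≤ suc n →
    G ↝ B ⊕ tents (s + L) R → G ↝ B ⊕ tents L (s + R)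
  spread zero _ _ _ G↝ = G↝
  spread (suc s) {G} {B} {L} {R} h≤1+L s+L<R bound G↝ =
    subst (λ r → G ↝ B ⊕ tents L r) (+-suc s R)
      (spread s {B = B} h≤1+L (≤-trans (<⇒≤ s+L<R) (n≤1+n R))
              (subst (λ m → m + h ≤ suc n) (sym (+-suc s R)) bound)
        (spread-step {B = B} (≤-trans h≤1+L (s≤s (m≤n+m L s))) (<⇒≤ s+L<R)
          (s≤s (≤-trans (+-monoˡ-≤ h (m≤n+m R s)) (s≤s⁻¹ bound))) G↝))

⌊n*2/2⌋≡n : ∀ n → ⌊ n * 2 /2⌋ ≡ n
⌊n*2/2⌋≡n zero    = refl
⌊n*2/2⌋≡n (suc n) = cong suc (⌊n*2/2⌋≡n n)

⌈n/2⌉≤1+⌊n/2⌋ : ∀ n → ⌈ n /2⌉ ≤ suc ⌊ n /2⌋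
⌈n/2⌉≤1+⌊n/2⌋ zero          = z≤n
⌈n/2⌉≤1+⌊n/2⌋ (suc zero)    = s≤s z≤n
⌈n/2⌉≤1+⌊n/2⌋ (suc (suc n)) = s≤s (⌈n/2⌉≤1+⌊n/2⌋ n)

module TwoTents (h′ n : ℕ) (h*2≤n : suc h′ * 2 ≤ n) where

  h : ℕ
  h = suc h′

  open HararyInterior h n
  open Reachability E

  L₀ R₀ : ℕ
  L₀ = ⌊ n /2⌋
  R₀ = ⌈ n /2⌉

  L₀+R₀≡n : L₀ + R₀ ≡ n
  L₀+R₀≡n = ⌊n/2⌋+⌈n/2⌉≡n n

  h≤L₀ : h ≤ L₀
  h≤L₀ = subst (_≤ L₀) (⌊n*2/2⌋≡n h) (⌊n/2⌋-mono h*2≤n)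

  h′≤n : h′ ≤ n
  h′≤n = ≤-trans (n≤1+n h′) (≤-trans h≤L₀ (⌊n/2⌋≤n n))

  reach : ∀ s {G B L} → s + L ≡ L₀ → s + R₀ + h ≤ suc n →
    G ↝ B ⊕ tents L₀ R₀ → G ↝ B ⊕ tents L (s + R₀)
  reach s {G} {B} {L} s+L≡L₀ bound G↝ =
    spread s {B = B} h≤1+L (subst (_≤ R₀) (sym s+L≡L₀) (⌊n/2⌋≤⌈n/2⌉ n)) bound
      (subst (λ l → G ↝ B ⊕ tents l R₀) (sym s+L≡L₀) G↝)
    where
    open ≤-Reasoning
    shuffle : ∀ s l r → suc (s + l + r) ≡ s + r + suc l
    shuffle = solve-∀
    h≤1+L : h ≤ suc L
    h≤1+L = +-cancelˡ-≤ (s + R₀) h (suc L) (begin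
      s + R₀ + h         ≤⟨ bound ⟩
      suc n              ≡⟨ cong suc (trans (sym L₀+R₀≡n) (cong (_+ R₀) (sym s+L≡L₀))) ⟩
      suc (s + L + R₀)   ≡⟨ shuffle s L R₀ ⟩
      s + R₀ + suc L     ∎)

  reach-left : ∀ {G B L} → h′ ≤ L → L ≤ L₀ →
    G ↝ B ⊕ tents L₀ R₀ → Σ ℕ λ R → G ↝ B ⊕ tents L R
  reach-left {B = B} {L} h′≤L L≤L₀ G↝ =
    L₀ ∸ L + R₀ , reach (L₀ ∸ L) {B = B} (m∸n+n≡m L≤L₀) bound G↝
    where
    open ≤-Reasoning
    shuffle : ∀ a r h → a + r + suc h ≡ suc (a + h + r)
    shuffle = solve-∀
    bound : L₀ ∸ L + R₀ + h ≤ suc n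
    bound = begin
      L₀ ∸ L + R₀ + suc h′    ≡⟨ shuffle (L₀ ∸ L) R₀ h′ ⟩
      suc (L₀ ∸ L + h′ + R₀)  ≤⟨ s≤s (+-monoˡ-≤ R₀ (+-monoʳ-≤ (L₀ ∸ L) h′≤L)) ⟩
      suc (L₀ ∸ L + L + R₀)   ≡⟨ cong (λ l → suc (l + R₀)) (m∸n+n≡m L≤L₀) ⟩
      suc (L₀ + R₀)           ≡⟨ cong suc L₀+R₀≡n ⟩
      suc n                   ∎

  reach-right : ∀ {G B R} → R₀ ≤ R → R + h ≤ suc n →
    G ↝ B ⊕ tents L₀ R₀ → Σ ℕ λ L → G ↝ B ⊕ tents L R
  reach-right {G} {B} {R} R₀≤R R+h≤N G↝ =
    L₀ ∸ s ,
    subst (λ r → G ↝ B ⊕ tents (L₀ ∸ s) r) (m∸n+n≡m R₀≤R)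
      (reach s {B = B} (m+[n∸m]≡n s≤L₀)
             (subst (λ r → r + h ≤ suc n) (sym (m∸n+n≡m R₀≤R)) R+h≤N) G↝)
    where
    open ≤-Reasoning
    s : ℕ
    s = R ∸ R₀
    s≤L₀ : s ≤ L₀
    s≤L₀ = begin
      R ∸ R₀         ≤⟨ ∸-monoˡ-≤ R₀ (s≤s⁻¹ (≤-trans (m<m+n R z<s) R+h≤N)) ⟩
      n ∸ R₀         ≡⟨ cong (_∸ R₀) L₀+R₀≡n ⟨
      L₀ + R₀ ∸ R₀   ≡⟨ m+n∸n≡m L₀ R₀ ⟩
      L₀             ∎

  near-left : ∀ {x} → x ≤ L₀ → Σ ℕ λ L → h′ ≤ L × L ≤ L₀ × ∣ L - x ∣ < h
  near-left {x} x≤L₀ =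
    x ⊔ h′ , m≤n⊔m x h′ , ⊔-lub x≤L₀ (≤-trans (n≤1+n h′) h≤L₀) ,
    s≤s (subst (_≤ h′) (sym (m≤n⇒∣n-m∣≡n∸m (m≤m⊔n x h′)))
                (m≤n+o⇒m∸n≤o (x ⊔ h′) x (m⊔n≤m+n x h′)))

  near-right : ∀ {x} → R₀ ≤ x → x ≤ n → Σ ℕ λ R → R₀ ≤ R × R + h ≤ suc n × ∣ R - x ∣ < h
  near-right {x} R₀≤x x≤n =
    R , ⊓-glb R₀≤n∸h′ R₀≤x , R+h≤N ,
    s≤s (subst (_≤ h′) (sym ∣R-x∣≡x∸m)
                (m≤n+o⇒m∸n≤o x (n ∸ h′) (subst (x ≤_) (sym m+h′≡n) x≤n)))
    where
    open ≤-Reasoning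
    R : ℕ
    R = (n ∸ h′) ⊓ x
    m+h′≡n : n ∸ h′ + h′ ≡ n
    m+h′≡n = m∸n+n≡m h′≤n
    ∣R-x∣≡x∸m : ∣ R - x ∣ ≡ x ∸ (n ∸ h′)
    ∣R-x∣≡x∸m = subst (λ y → ∣ R - y ∣ ≡ x ∸ (n ∸ h′)) (m⊓n+n∸m≡n (n ∸ h′) x)
                      (∣m-m+n∣≡n R (x ∸ (n ∸ h′)))
    R₀≤n∸h′ : R₀ ≤ n ∸ h′
    R₀≤n∸h′ = m+n≤o⇒m≤o∸n R₀ (begin
      R₀ + h′   ≤⟨ +-monoʳ-≤ R₀ (≤-trans (n≤1+n h′) h≤L₀) ⟩
      R₀ + L₀   ≡⟨ +-comm R₀ L₀ ⟩
      L₀ + R₀   ≡⟨ L₀+R₀≡n ⟩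
      n         ∎)
    R+h≤N : R + h ≤ suc n
    R+h≤N = begin
      R + suc h′          ≡⟨ +-suc R h′ ⟩
      suc (R + h′)        ≤⟨ s≤s (+-monoˡ-≤ h′ (m⊓n≤m (n ∸ h′) x)) ⟩
      suc (n ∸ h′ + h′)   ≡⟨ cong suc m+h′≡n ⟩
      suc n               ∎

  reach-covering : ∀ {G B} → G ↝ B ⊕ tents L₀ R₀ → ∀ x → x ≤ n →
    Σ ℕ λ L → Σ ℕ λ R → G ↝ B ⊕ tents L R × 0 < tent h L x + tent h R x
  reach-covering {G} {B} G↝ x x≤n with x ≤? L₀
  ... | yes x≤L₀ =
    let L , h′≤L , L≤L₀ , near = near-left x≤L₀
        R , G↝′ = reach-left {B = B} h′≤L L≤L₀ G↝
    in L , R , G↝′ , ≤-trans (tent-positive {c = L} near) (m≤m+n _ _)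
  ... | no x≰L₀ =
    let R , R₀≤R , R+h≤N , near = near-right (≤-trans (⌈n/2⌉≤1+⌊n/2⌋ n) (≰⇒> x≰L₀)) x≤n
        L , G↝′ = reach-right {B = B} R₀≤R R+h≤N G↝
    in L , R , G↝′ , ≤-trans (tent-positive {c = R} near) (m≤n+m _ _)

  positiveRank-tents : PositiveRank E (tents L₀ R₀)
  positiveRank-tents = positiveRank-↝ covering
    where
    covering : ∀ q →
      Σ (Divisor (suc n)) λ D′ → Effective E D′ × minusPoint E (tents L₀ R₀) q ↝ D′
    covering q =
      let L , R , G↝ , positive =
            reach-covering {B = minusPoint E (λ _ → + 0) q}
              (_ , ε , minusPoint-≗ (tents L₀ R₀) q) (toℕ q) (s≤s⁻¹ (toℕ<n q))
      in minusPoint E (tents L R) q ,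
         minusPoint-effective {tents L R} {q} (λ _ → +≤+ z≤n) (+≤+ positive) ,
         ↝-respʳ-≗ (λ w → sym (minusPoint-≗ (tents L R) q w)) G↝

  degree-tents : degree E (tents L₀ R₀)
    ℤ.≤ + ((tetrahedral h′ + tetrahedral h) + (tetrahedral h′ + tetrahedral h))
  degree-tents = ℤ.≤-trans
    (ℤ.≤-reflexive
      (sumℤ≡+sum (suc n) (tents L₀ R₀) (λ x → tent h L₀ x + tent h R₀ x) (λ _ → refl)))
    (+≤+ (begin
      sum (applyUpTo (λ x → tent h L₀ x + tent h R₀ x) (suc n))
        ≡⟨ sum-applyUpTo-+ (tent h L₀) (tent h R₀) (suc n) ⟩
      sum (applyUpTo (tent h L₀) (suc n)) + sum (applyUpTo (tent h R₀) (suc n))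
        ≤⟨ +-mono-≤ (sum-tent h′ (m≤n⇒m≤1+n (⌊n/2⌋≤n n)))
                    (sum-tent h′ (m≤n⇒m≤1+n (⌈n/2⌉≤n n))) ⟩
      (tetrahedral h′ + tetrahedral h) + (tetrahedral h′ + tetrahedral h) ∎))
    where open ≤-Reasoning

  gonality : GonalityAtMost E (+ ((suc h′ * 2 * (suc h′ * 2 + 1) * (suc h′ * 2 + 2)) / 12))
  gonality =
    tents L₀ R₀ , positiveRank-tents ,
    subst (λ b → degree E (tents L₀ R₀) ℤ.≤ + b) t+t≡ degree-tents
    where
    open ≡-Reasoning
    t : ℕ
    t = tetrahedral h′ + tetrahedral h
    double : ∀ t → (t + t) * 12 ≡ t * 24
    double = solve-∀
    t+t≡ : t + t ≡ suc h′ * 2 * (suc h′ * 2 + 1) * (suc h′ * 2 + 2) / 12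
    t+t≡ = begin
      t + t              ≡⟨ m*n/n≡m (t + t) 12 ⟨
      (t + t) * 12 / 12  ≡⟨ cong (_/ 12) (trans (double t) (tetrahedral-pair h′)) ⟩
      suc h′ * 2 * (suc h′ * 2 + 1) * (suc h′ * 2 + 2) / 12 ∎

corollary3p2 : (k n : ℕ) → 2 ∣ k → 2 ≤ k → k + 1 ≤ n →
    GonalityAtMost (hararyEdges k n) (+ ((k * (k + 1) * (k + 2)) / 12))
corollary3p2 _ n       (divides zero     refl) ()  _
corollary3p2 _ zero    (divides (suc h′) refl) _   ()
corollary3p2 _ (suc n) (divides (suc h′) refl) _   k+1≤1+n =
  TwoTents.gonality h′ n (s≤s⁻¹ (subst (_≤ suc n) (+-comm (suc h′ * 2) 1) k+1≤1+n))
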